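{- Let $G$ be a nontrivial uniquely $C_4^{+}$-saturated graph. Then $G$ has girth $3$ or $4$.
   Context: All graphs are finite, simple and undirected. $C_4^{+}$ (the diamond) is the graph obtained from a $4$-cycle by adding one chord, i.e. $K_4$ minus an edge. For a graph $H$, a graph $G$ is uniquely $H$-saturated if $G$ contains no subgraph isomorphic to $H$, but for every pair of non-adjacent vertices $u,v$ of $G$, the graph $G+uv$ contains exactly one subgraph isomorphic to $H$. A uniquely $H$-saturated graph is nontrivial if it has at least $|V(H)|$ vertices. The girth of a graph is the minimum length of a cycle in it. -}

module Defs where

open import Data.Nat using (ℕ; zero; suc; _≤_; _<_; _≡ᵇ_)
open import Data.Fin using (Fin; toℕ; _≟_)
open import Data.Bool using (Bool; true; false; _∧_; _∨_; not; T)
open import Data.Product using (Σ; ∃; _×_; _,_)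
open import Data.Sum using (_⊎_)
open import Relation.Nullary using (¬_)
open import Relation.Nullary.Decidable using (⌊_⌋)
open import Relation.Binary.PropositionalEquality using (_≡_; _≢_)
open import Function.Definitions using (Injective)

record Graph : Set where
  field
    n   : ℕ
    adj : Fin n → Fin n → Bool

open Graph public

Adj : (G : Graph) → Fin (n G) → Fin (n G) → Set
Adj G x y = adj G x y ≡ true

IsSimple : Graph → Set
IsSimple G = (∀ x y → adj G x y ≡ adj G y x) × (∀ x → adj G x x ≡ false)

addEdge : (G : Graph) → Fin (n G) → Fin (n G) → Graph
addEdge G u v = record
  { n = n G
  ; adj = λ x y → adj G x y ∨ ((⌊ x ≟ u ⌋ ∧ ⌊ y ≟ v ⌋) ∨ (⌊ x ≟ v ⌋ ∧ ⌊ y ≟ u ⌋)) }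

Copy : Graph → Graph → Set
Copy H G = Σ (Fin (n H) → Fin (n G)) λ f →
  Injective _≡_ _≡_ f × (∀ i j → Adj H i j → Adj G (f i) (f j))

Contains : Graph → Graph → Set
Contains H G = Copy H G

-- two copies determine the same subgraph of G (same vertex set and same edge set)
SameSubgraph : (H G : Graph) → Copy H G → Copy H G → Set
SameSubgraph H G (f , _) (g , _) =
  (∀ x → ((∃ λ i → f i ≡ x) → (∃ λ i → g i ≡ x)) × ((∃ λ i → g i ≡ x) → (∃ λ i → f i ≡ x)))
  × (∀ x y →
      ((∃ λ i → ∃ λ j → Adj H i j × f i ≡ x × f j ≡ y) → (∃ λ i → ∃ λ j → Adj H i j × g i ≡ x × g j ≡ y))
      × ((∃ λ i → ∃ λ j → Adj H i j × g i ≡ x × g j ≡ y) → (∃ λ i → ∃ λ j → Adj H i j × f i ≡ x × f j ≡ y)))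

ContainsExactlyOne : Graph → Graph → Set
ContainsExactlyOne H G = Σ (Copy H G) λ c → ∀ c' → SameSubgraph H G c c'

UniquelySaturated : Graph → Graph → Set
UniquelySaturated H G =
  ¬ Contains H G ×
  (∀ u v → u ≢ v → adj G u v ≡ false → ContainsExactlyOne H (addEdge G u v))

Nontrivial : Graph → Graph → Set
Nontrivial H G = n H ≤ n G

-- the diamond C4+ = K4 minus the edge {2,3}; vertices 0,1,2,3
diamond : Graph
diamond = record { n = 4 ; adj = λ i j → not ⌊ i ≟ j ⌋ ∧ not (isPair23 (toℕ i) (toℕ j)) }
  where
  isPair23 : ℕ → ℕ → Bool
  isPair23 a b = ((a ≡ᵇ 2) ∧ (b ≡ᵇ 3)) ∨ ((a ≡ᵇ 3) ∧ (b ≡ᵇ 2))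

-- the cycle C_l on Fin l (meaningful for l ≥ 3): i ~ i+1, and l-1 ~ 0
cycleGraph : ℕ → Graph
cycleGraph l = record { n = l ; adj = λ i j → step (toℕ i) (toℕ j) ∨ step (toℕ j) (toℕ i) }
  where
  step : ℕ → ℕ → Bool
  step a b = (suc a ≡ᵇ b) ∨ ((suc a ≡ᵇ l) ∧ (b ≡ᵇ 0))

HasCycleOfLength : Graph → ℕ → Set
HasCycleOfLength G l = 3 ≤ l × Contains (cycleGraph l) G

HasGirth : Graph → ℕ → Set
HasGirth G g = HasCycleOfLength G g × (∀ l → l < g → ¬ HasCycleOfLength G l)

{-# OPTIONS --safe #-}
module Submission where

-- If G has a triangle its girth is 3. Otherwise G, having at least three vertices, has a
-- non-adjacent pair u, v, and G + uv contains a diamond. As G is triangle-free, both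
-- triangles of that diamond use the new edge uv, which must therefore be their common
-- edge; the remaining four edges of the diamond form a 4-cycle of G, so the girth is 4.

open import Defs
open import Data.Bool using (true; false)
import Data.Bool.Properties as Bool
open import Data.Empty using (⊥-elim)
open import Data.Fin using (Fin; inject≤; _≟_)
open import Data.Fin.Patterns using (0F; 1F; 2F; 3F)
open import Data.Fin.Permutation using (Permutation′; transpose; _⟨$⟩ʳ_)
open import Data.Fin.Properties using (any?; inject≤-injective)
open import Data.Nat using (_≤_; _<_)
open import Data.Nat.Properties using (≤-refl; n≤1+n; <⇒≱; <⇒≤; m<1+n⇒m<n∨m≡n)
open import Data.Product using (Σ; ∃₂; _×_; _,_; proj₁; proj₂)
open import Data.Sum using (_⊎_; inj₁; inj₂; [_,_])
import Data.Sum as Sum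
open import Function using (_∘_; _$_; case_of_)
open import Function.Bundles using (Injection)
open import Function.Properties.Inverse using (↔⇒↣)
open import Relation.Nullary using (¬_; Dec; yes; no; contradiction)
open import Relation.Nullary.Decidable using (_×-dec_)
open import Relation.Binary.PropositionalEquality using (_≡_; _≢_; refl; sym; trans)

Triangle : Graph → Set
Triangle G = Σ (Fin (n G)) λ x → Σ (Fin (n G)) λ y → Σ (Fin (n G)) λ z →
  Adj G x y × Adj G y z × Adj G x z

triangle? : (G : Graph) → Dec (Triangle G)
triangle? G = any? λ x → any? λ y → any? λ z →
  (adj G x y Bool.≟ true) ×-dec (adj G y z Bool.≟ true) ×-dec (adj G x z Bool.≟ true)

Loopless : Graph → Set
Loopless G = ∀ x → ¬ Adj G x x

simple⇒loopless : ∀ {G} → IsSimple G → Loopless G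
simple⇒loopless (_ , irreflexive) x xx = case trans (sym xx) (irreflexive x) of λ ()

Adj⇒≢ : ∀ {G x y} → Loopless G → Adj G x y → x ≢ y
Adj⇒≢ loopless xy refl = loopless _ xy

complete-copy : ∀ {H G} → Loopless H → Loopless G → (g : Fin (n H) → Fin (n G)) →
  (∀ i j → i ≢ j → Adj G (g i) (g j)) → Copy H G
complete-copy {H} {G} loopless-H loopless-G g complete = g , injective , edges
  where
  injective : ∀ {i j} → g i ≡ g j → i ≡ j
  injective {i} {j} gi≡gj with i ≟ j
  ... | yes i≡j = i≡j
  ... | no i≢j = contradiction gi≡gj (Adj⇒≢ {G} loopless-G (complete i j i≢j))

  edges : ∀ i j → Adj H i j → Adj G (g i) (g j)
  edges i j ij = complete i j (Adj⇒≢ {H} loopless-H ij)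

cycle3-loopless : Loopless (cycleGraph 3)
cycle3-loopless 0F ()
cycle3-loopless 1F ()
cycle3-loopless 2F ()

triangle⇒cycle3 : ∀ {G} → IsSimple G → Triangle G → Copy (cycleGraph 3) G
triangle⇒cycle3 {G} simple@(symmetric , _) (x , y , z , xy , yz , xz) =
  complete-copy {G = G} cycle3-loopless (simple⇒loopless {G} simple) vertex complete
  where
  flip : ∀ {a b} → Adj G a b → Adj G b a
  flip {a} {b} ab = trans (symmetric b a) ab

  vertex : Fin 3 → Fin (n G)
  vertex 0F = x
  vertex 1F = y
  vertex 2F = z

  complete : ∀ i j → i ≢ j → Adj G (vertex i) (vertex j)
  complete 0F 1F _ = xy
  complete 0F 2F _ = xz
  complete 1F 0F _ = flip xy
  complete 1F 2F _ = yz
  complete 2F 0F _ = flip xz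
  complete 2F 1F _ = flip yz
  complete 0F 0F i≢i = contradiction refl i≢i
  complete 1F 1F i≢i = contradiction refl i≢i
  complete 2F 2F i≢i = contradiction refl i≢i

cycle3⇒triangle : ∀ {G} → Copy (cycleGraph 3) G → Triangle G
cycle3⇒triangle (f , _ , edge) =
  f 0F , f 1F , f 2F , edge 0F 1F refl , edge 1F 2F refl , edge 0F 2F refl

module AddedEdge (G : Graph) (u v : Fin (n G)) where

  Endpoint : Fin (n G) → Set
  Endpoint w = w ≡ u ⊎ w ≡ v

  IsAddedEdge : Fin (n G) → Fin (n G) → Set
  IsAddedEdge x y = (x ≡ u × y ≡ v) ⊎ (x ≡ v × y ≡ u)

  addEdge-adj : ∀ {x y} → Adj (addEdge G u v) x y → Adj G x y ⊎ IsAddedEdge x y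
  addEdge-adj {x} {y} xy with adj G x y | x ≟ u | y ≟ v | x ≟ v | y ≟ u
  ... | true  | _       | _       | _       | _       = inj₁ refl
  ... | false | yes x≡u | yes y≡v | _       | _       = inj₂ (inj₁ (x≡u , y≡v))
  ... | false | _       | _       | yes x≡v | yes y≡u = inj₂ (inj₂ (x≡v , y≡u))
  ... | false | no _    | _       | no _    | _       = case xy of λ ()
  ... | false | no _    | _       | yes _   | no _    = case xy of λ ()
  ... | false | yes _   | no _    | no _    | _       = case xy of λ ()
  ... | false | yes _   | no _    | yes _   | no _    = case xy of λ ()

  addedEdge-endpoints : ∀ {x y} → IsAddedEdge x y → Endpoint x × Endpoint y
  addedEdge-endpoints (inj₁ (x≡u , y≡v)) = inj₁ x≡u , inj₂ y≡v
  addedEdge-endpoints (inj₂ (x≡v , y≡u)) = inj₂ x≡v , inj₁ y≡u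

  addEdge-adj-avoiding : ∀ {x y} → Adj (addEdge G u v) x y → ¬ Endpoint x ⊎ ¬ Endpoint y →
    Adj G x y
  addEdge-adj-avoiding xy avoids with addEdge-adj xy
  ... | inj₁ xy∈G = xy∈G
  ... | inj₂ added with addedEdge-endpoints added
  ...   | x-end , y-end = ⊥-elim ([ _$ x-end , _$ y-end ] avoids)

  addedEdge-endpoint : ∀ {x y w} → IsAddedEdge x y → Endpoint w → w ≡ x ⊎ w ≡ y
  addedEdge-endpoint (inj₁ (refl , refl)) (inj₁ refl) = inj₁ refl
  addedEdge-endpoint (inj₁ (refl , refl)) (inj₂ refl) = inj₂ refl
  addedEdge-endpoint (inj₂ (refl , refl)) (inj₁ refl) = inj₂ refl
  addedEdge-endpoint (inj₂ (refl , refl)) (inj₂ refl) = inj₁ refl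

  endpoint-on-triangle : ¬ Triangle G → ∀ {x y z w} →
    Adj (addEdge G u v) x y → Adj (addEdge G u v) y z → Adj (addEdge G u v) x z →
    Endpoint w → w ≡ x ⊎ w ≡ y ⊎ w ≡ z
  endpoint-on-triangle triangle-free xy yz xz w-end
    with addEdge-adj xy | addEdge-adj yz | addEdge-adj xz
  ... | inj₁ xy∈G  | inj₁ yz∈G  | inj₁ xz∈G  =
    contradiction (_ , _ , _ , xy∈G , yz∈G , xz∈G) triangle-free
  ... | inj₂ added | _          | _          = Sum.map₂ inj₁ (addedEdge-endpoint added w-end)
  ... | inj₁ _     | inj₂ added | _          = inj₂ (addedEdge-endpoint added w-end)
  ... | inj₁ _     | inj₁ _     | inj₂ added = Sum.map₂ inj₂ (addedEdge-endpoint added w-end)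

  -- Vertices 0F, 1F of the diamond span its hub edge and 2F, 3F are its tips; both triangles
  -- contain the new edge, so no tip is an endpoint of it. Swapping 1F and 2F lists the rim
  -- 0F 2F 1F 3F in cyclic order.
  diamond⇒cycle4 : ¬ Triangle G → Copy diamond (addEdge G u v) → Copy (cycleGraph 4) G
  diamond⇒cycle4 triangle-free (f , injective , edge) =
    f ∘ (rim ⟨$⟩ʳ_) , Injection.injective (↔⇒↣ rim) ∘ injective , cycle
    where
    rim : Permutation′ 4
    rim = transpose 1F 2F

    off-triangle : ∀ {t a b c} →
      Adj (addEdge G u v) (f a) (f b) → Adj (addEdge G u v) (f b) (f c) →
      Adj (addEdge G u v) (f a) (f c) → ¬ (t ≡ a ⊎ t ≡ b ⊎ t ≡ c) → ¬ Endpoint (f t)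
    off-triangle ab bc ac t∉abc t-end =
      t∉abc (Sum.map injective (Sum.map injective injective)
        (endpoint-on-triangle triangle-free ab bc ac t-end))

    tip₂ : ¬ Endpoint (f 2F)
    tip₂ = off-triangle (edge 0F 1F refl) (edge 1F 3F refl) (edge 0F 3F refl)
      λ { (inj₁ ()) ; (inj₂ (inj₁ ())) ; (inj₂ (inj₂ ())) }

    tip₃ : ¬ Endpoint (f 3F)
    tip₃ = off-triangle (edge 0F 1F refl) (edge 1F 2F refl) (edge 0F 2F refl)
      λ { (inj₁ ()) ; (inj₂ (inj₁ ())) ; (inj₂ (inj₂ ())) }

    toward : ∀ {i t} → ¬ Endpoint (f t) → Adj diamond i t → Adj G (f i) (f t)
    toward tip it = addEdge-adj-avoiding (edge _ _ it) (inj₂ tip)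

    from : ∀ {i t} → ¬ Endpoint (f t) → Adj diamond t i → Adj G (f t) (f i)
    from tip ti = addEdge-adj-avoiding (edge _ _ ti) (inj₁ tip)

    cycle : ∀ i j → Adj (cycleGraph 4) i j → Adj G (f (rim ⟨$⟩ʳ i)) (f (rim ⟨$⟩ʳ j))
    cycle 0F 1F _ = toward tip₂ refl
    cycle 1F 0F _ = from tip₂ refl
    cycle 1F 2F _ = from tip₂ refl
    cycle 2F 1F _ = toward tip₂ refl
    cycle 2F 3F _ = toward tip₃ refl
    cycle 3F 2F _ = from tip₃ refl
    cycle 3F 0F _ = from tip₃ refl
    cycle 0F 3F _ = toward tip₃ refl
    cycle 0F 0F ()
    cycle 1F 1F ()
    cycle 2F 2F ()
    cycle 3F 3F ()
    cycle 0F 2F ()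
    cycle 2F 0F ()
    cycle 1F 3F ()
    cycle 3F 1F ()

no-cycle-shorter-than-3 : ∀ G l → l < 3 → ¬ HasCycleOfLength G l
no-cycle-shorter-than-3 G l l<3 (3≤l , _) = <⇒≱ l<3 3≤l

triangle⇒girth3 : ∀ G → IsSimple G → Triangle G → HasGirth G 3
triangle⇒girth3 G simple triangle =
  (≤-refl , triangle⇒cycle3 simple triangle) , no-cycle-shorter-than-3 G

cycle4⇒girth4 : ∀ G → ¬ Triangle G → Copy (cycleGraph 4) G → HasGirth G 4
cycle4⇒girth4 G triangle-free square = (n≤1+n 3 , square) , no-shorter-cycle
  where
  no-shorter-cycle : ∀ l → l < 4 → ¬ HasCycleOfLength G l
  no-shorter-cycle l l<4 with m<1+n⇒m<n∨m≡n l<4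
  ... | inj₁ l<3 = no-cycle-shorter-than-3 G l l<3
  ... | inj₂ refl = triangle-free ∘ cycle3⇒triangle ∘ proj₂

NonAdjacentPair : Graph → Set
NonAdjacentPair G = ∃₂ λ u v → u ≢ v × adj G u v ≡ false

nonAdjacentPair-among : ∀ G → ¬ Triangle G → ∀ a b c → a ≢ b → b ≢ c → a ≢ c →
  NonAdjacentPair G
nonAdjacentPair-among G triangle-free a b c a≢b b≢c a≢c
  with adj G a b in ab | adj G b c in bc | adj G a c in ac
... | false | _     | _     = a , b , a≢b , ab
... | true  | false | _     = b , c , b≢c , bc
... | true  | true  | false = a , c , a≢c , ac
... | true  | true  | true  = contradiction (a , b , c , ab , bc , ac) triangle-free

triangle-free⇒nonAdjacentPair : ∀ G → ¬ Triangle G → 3 ≤ n G → NonAdjacentPair G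
triangle-free⇒nonAdjacentPair G triangle-free 3≤n =
  nonAdjacentPair-among G triangle-free (vertex 0F) (vertex 1F) (vertex 2F)
    ((λ ()) ∘ inject≤-injective 3≤n 3≤n 0F 1F)
    ((λ ()) ∘ inject≤-injective 3≤n 3≤n 1F 2F)
    ((λ ()) ∘ inject≤-injective 3≤n 3≤n 0F 2F)
  where
  vertex : Fin 3 → Fin (n G)
  vertex i = inject≤ i 3≤n

lemma2p4 : (G : Graph) → IsSimple G → Nontrivial diamond G → UniquelySaturated diamond G →
    HasGirth G 3 ⊎ HasGirth G 4
lemma2p4 G simple nontrivial (_ , saturated) with triangle? G
... | yes triangle = inj₁ (triangle⇒girth3 G simple triangle)
... | no triangle-free with triangle-free⇒nonAdjacentPair G triangle-free (<⇒≤ nontrivial)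
...   | u , v , u≢v , uv∉G = inj₂ (cycle4⇒girth4 G triangle-free
        (AddedEdge.diamond⇒cycle4 G u v triangle-free (proj₁ (saturated u v u≢v uv∉G))))
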